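{- Let $F(n)$ be the Fibonacci numbers ($F(0)=0$, $F(1)=1$, $F(n)=F(n-1)+F(n-2)$) and $p$ a positive integer. Then the functions $n\mapsto F(n)^iF(n+1)^{p-i}$, $0\le i\le p$, on $\{0,1,2,\dots\}$ are linearly independent, and the set consisting of these functions together with $n\mapsto n$ and $n\mapsto 1$ is linearly independent unless $p$ is divisible by $4$, in which case the space of linear relations among its elements is one-dimensional. -}

module Defs where

open import Data.Nat as ℕ using (ℕ; zero; suc; _∸_; _^_)
open import Data.Fin using (Fin; zero; suc; toℕ)
open import Data.Integer using (+_)
open import Data.Rational using (ℚ; 0ℚ; _+_; _*_; _/_)
open import Data.Product using (Σ; _×_; ∃)
open import Relation.Binary.PropositionalEquality using (_≡_)
open import Relation.Nullary using (¬_)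

fib : ℕ → ℕ
fib zero = 0
fib (suc zero) = 1
fib (suc (suc n)) = fib (suc n) ℕ.+ fib n

ℕ→ℚ : ℕ → ℚ
ℕ→ℚ k = (+ k) / 1

∑ : ∀ {m} → (Fin m → ℚ) → ℚ
∑ {zero} g = 0ℚ
∑ {suc m} g = g zero + ∑ (λ j → g (suc j))

IsRelation : ∀ {m} → (Fin m → ℕ → ℚ) → (Fin m → ℚ) → Set
IsRelation f c = ∀ (n : ℕ) → ∑ (λ j → c j * f j n) ≡ 0ℚ

LinIndep : ∀ {m} → (Fin m → ℕ → ℚ) → Set
LinIndep {m} f = ∀ (c : Fin m → ℚ) → IsRelation f c → ∀ j → c j ≡ 0ℚ

RelSpaceDim1 : ∀ {m} → (Fin m → ℕ → ℚ) → Set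
RelSpaceDim1 {m} f =
  Σ (Fin m → ℚ) λ c → IsRelation f c × ¬ (∀ j → c j ≡ 0ℚ)
    × (∀ (d : Fin m → ℚ) → IsRelation f d → ∃ λ (a : ℚ) → ∀ j → d j ≡ a * c j)

powFam : (p : ℕ) → Fin (suc p) → ℕ → ℚ
powFam p i n = ℕ→ℚ ((fib n ^ toℕ i) ℕ.* (fib (suc n) ^ (p ∸ toℕ i)))

extFam : (p : ℕ) → Fin (suc (suc (suc p))) → ℕ → ℚ
extFam p zero n = ℕ→ℚ n
extFam p (suc zero) n = ℕ→ℚ 1
extFam p (suc (suc i)) n = powFam p i n

{-# OPTIONS --safe #-}

-- Clearing denominators turns a linear relation among n, 1 and the F n ^ i F (n + 1) ^ (p - i)
-- into a n + b + f (F n, F (n + 1)) = 0 with a, b ∈ ℤ and f a binary form of degree p over ℤ.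
-- Modulo F n we have F (k n) ≡ 0 and F (k n + 1) ≡ F (n + 1) ^ k, and Cassini's identity gives
-- F (n + 1) ^ 2 ≡ (-1) ^ n, so at the index k n the form reduces to its y ^ p coefficient c₀
-- times ±1.  Comparing the indices 0 and 4 n gives 4 a n ≡ 0; when 4 ∤ p, comparing 0 and k n,
-- with k p twice an odd number and n odd, gives 2 c₀ ≡ 0.  Since F n outgrows every multiple
-- of n, a = 0 and c₀ = -b = 0.  A form vanishing at all (F n, F (n + 1)) likewise has c₀ = 0,
-- so it is x times a form vanishing there (n ≥ 1), and it is zero by induction on the degree.
-- When 4 ∣ p, Cassini makes (y ^ 2 - x y - x ^ 2) ^ (p / 2) equal to 1 at these points; this
-- gives the relation, and any other one differs from a multiple of it by a vanishing form.

module Submission where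

open import Defs
open import Data.Nat using (ℕ; _≤_)
open import Data.Nat.Divisibility using (_∣_)
open import Data.Product using (_×_)
open import Relation.Nullary using (¬_)

open import Algebra.Bundles using (CommutativeMonoid)
open import Data.Empty using (⊥-elim)
open import Data.Fin.Base using (Fin; zero; suc; toℕ)
open import Data.Integer.Base as ℤ using (ℤ; +_; 0ℤ; 1ℤ; -1ℤ; _+_; _-_; _*_; -_; _^_; ∣_∣)
import Data.Integer.Properties as ℤ
open import Data.Integer.Tactic.RingSolver using (solve-∀)
open import Data.Nat.Base as ℕ using (zero; suc; _<_; _∸_)
open import Data.Nat.Divisibility using (divides; _∣0; ∣-refl; ∣m∣n⇒∣m+n)
import Data.Nat.Properties as ℕ
open import Data.Nat.Tactic.RingSolver using () renaming (solve-∀ to ℕ-solve-∀)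
open import Data.Product using (_,_; ∃; ∃₂)
open import Data.Rational.Base as ℚ using (ℚ; 0ℚ; 1ℚ; _/_; ↥_; ↧_; toℚᵘ; 1/_)
import Data.Rational.Properties as ℚ
open import Data.Rational.Unnormalised.Base as ℚᵘ using (mkℚᵘ; *≡*)
import Data.Rational.Unnormalised.Properties as ℚᵘ
open import Data.Sum using ([_,_]′)
open import Data.Vec.Functional using (Vector; []; _∷_; head; tail; map; zipWith)
open import Function.Base using (id; _∘_)
open import Level using (0ℓ)
open import Relation.Binary.Bundles using (Setoid)
open import Relation.Binary.PropositionalEquality
import Relation.Binary.Reasoning.Setoid as ≈-Reasoning

open import Algebra.Properties.CommutativeSemigroup
  (CommutativeMonoid.commutativeSemigroup ℚ.*-1-commutativeMonoid) using (xy∙z≈xz∙y; x∙yz≈y∙xz)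

-- Binary forms over ℤ

Form : ℕ → Set
Form p = Vector ℤ (suc p)

-- The coefficient at index i belongs to the monomial x ^ i * y ^ (p - i).
⟦_⟧ : ∀ {p} → Form p → ℤ → ℤ → ℤ
⟦_⟧ {zero}  c x y = head c
⟦_⟧ {suc p} c x y = head c * y ^ suc p + x * ⟦ tail c ⟧ x y

infixl 6 _⊕_
infixl 7 _⊙_ _⊛_
infixr 8 x·_ y·_ y^_·_

_⊕_ : ∀ {p} → Form p → Form p → Form p
_⊕_ = zipWith _+_

_⊙_ : ∀ {p} → ℤ → Form p → Form p
k ⊙ c = map (k *_) c

x·_ : ∀ {p} → Form p → Form (suc p)
x· c = 0ℤ ∷ c

y·_ : ∀ {p} → Form p → Form (suc p)
y·_ {zero}  c = head c ∷ 0ℤ ∷ []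
y·_ {suc p} c = head c ∷ y· tail c

y^_·_ : ∀ {p} k → Form p → Form (k ℕ.+ p)
y^ zero  · c = c
y^ suc k · c = y· y^ k · c

_⊛_ : ∀ {p q} → Form p → Form q → Form (p ℕ.+ q)
_⊛_ {zero}  c d = head c ⊙ d
_⊛_ {suc p} c d = head c ⊙ y^ suc p · d ⊕ x· (tail c ⊛ d)

_⊛^_ : ∀ {p} → Form p → (m : ℕ) → Form (m ℕ.* p)
c ⊛^ zero  = 1ℤ ∷ []
c ⊛^ suc m = c ⊛ (c ⊛^ m)

module _ (x y : ℤ) where

  ⟦⊕⟧ : ∀ {p} (c d : Form p) → ⟦ c ⊕ d ⟧ x y ≡ ⟦ c ⟧ x y + ⟦ d ⟧ x y
  ⟦⊕⟧ {zero}  c d = refl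
  ⟦⊕⟧ {suc p} c d = trans (cong (λ t → (head c + head d) * y ^ suc p + x * t) (⟦⊕⟧ (tail c) (tail d)))
                          (rearrange (head c) (head d) (y ^ suc p) x (⟦ tail c ⟧ x y) (⟦ tail d ⟧ x y))
    where
    rearrange : ∀ a b Y x s t → (a + b) * Y + x * (s + t) ≡ (a * Y + x * s) + (b * Y + x * t)
    rearrange = solve-∀

  ⟦⊙⟧ : ∀ {p} k (c : Form p) → ⟦ k ⊙ c ⟧ x y ≡ k * ⟦ c ⟧ x y
  ⟦⊙⟧ {zero}  k c = refl
  ⟦⊙⟧ {suc p} k c = trans (cong (λ t → k * head c * y ^ suc p + x * t) (⟦⊙⟧ k (tail c)))
                          (rearrange k (head c) (y ^ suc p) x (⟦ tail c ⟧ x y))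
    where
    rearrange : ∀ k a Y x t → k * a * Y + x * (k * t) ≡ k * (a * Y + x * t)
    rearrange = solve-∀

  ⟦x·⟧ : ∀ {p} (c : Form p) → ⟦ x· c ⟧ x y ≡ x * ⟦ c ⟧ x y
  ⟦x·⟧ c = ℤ.+-identityˡ (x * ⟦ c ⟧ x y)

  ⟦y·⟧ : ∀ {p} (c : Form p) → ⟦ y· c ⟧ x y ≡ y * ⟦ c ⟧ x y
  ⟦y·⟧ {zero}  c = rearrange (head c) x y
    where
    rearrange : ∀ a x y → a * (y * 1ℤ) + x * 0ℤ ≡ y * a
    rearrange = solve-∀
  ⟦y·⟧ {suc p} c = trans (cong (λ t → head c * y ^ suc (suc p) + x * t) (⟦y·⟧ (tail c)))
                         (rearrange (head c) (y ^ suc p) x y (⟦ tail c ⟧ x y))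
    where
    rearrange : ∀ a Y x y t → a * (y * Y) + x * (y * t) ≡ y * (a * Y + x * t)
    rearrange = solve-∀

  ⟦y^·⟧ : ∀ {p} k (c : Form p) → ⟦ y^ k · c ⟧ x y ≡ y ^ k * ⟦ c ⟧ x y
  ⟦y^·⟧ zero    c = sym (ℤ.*-identityˡ (⟦ c ⟧ x y))
  ⟦y^·⟧ (suc k) c = begin
    ⟦ y· y^ k · c ⟧ x y          ≡⟨ ⟦y·⟧ (y^ k · c) ⟩
    y * ⟦ y^ k · c ⟧ x y         ≡⟨ cong (y *_) (⟦y^·⟧ k c) ⟩
    y * (y ^ k * ⟦ c ⟧ x y)      ≡⟨ ℤ.*-assoc y (y ^ k) (⟦ c ⟧ x y) ⟨
    y ^ suc k * ⟦ c ⟧ x y        ∎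
    where open ≡-Reasoning

  ⟦⊛⟧ : ∀ {p q} (c : Form p) (d : Form q) → ⟦ c ⊛ d ⟧ x y ≡ ⟦ c ⟧ x y * ⟦ d ⟧ x y
  ⟦⊛⟧ {zero}  c d = ⟦⊙⟧ (head c) d
  ⟦⊛⟧ {suc p} c d = begin
    ⟦ head c ⊙ y^ suc p · d ⊕ x· (tail c ⊛ d) ⟧ x y
      ≡⟨ ⟦⊕⟧ (head c ⊙ y^ suc p · d) (x· (tail c ⊛ d)) ⟩
    ⟦ head c ⊙ y^ suc p · d ⟧ x y + ⟦ x· (tail c ⊛ d) ⟧ x y
      ≡⟨ cong₂ _+_ (trans (⟦⊙⟧ (head c) (y^ suc p · d)) (cong (head c *_) (⟦y^·⟧ (suc p) d)))
                   (trans (⟦x·⟧ (tail c ⊛ d)) (cong (x *_) (⟦⊛⟧ (tail c) d))) ⟩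
    head c * (y ^ suc p * ⟦ d ⟧ x y) + x * (⟦ tail c ⟧ x y * ⟦ d ⟧ x y)
      ≡⟨ rearrange (head c) (y ^ suc p) x (⟦ tail c ⟧ x y) (⟦ d ⟧ x y) ⟩
    ⟦ c ⟧ x y * ⟦ d ⟧ x y ∎
    where
    open ≡-Reasoning
    rearrange : ∀ a Y x t s → a * (Y * s) + x * (t * s) ≡ (a * Y + x * t) * s
    rearrange = solve-∀

  ⟦⊛^⟧ : ∀ {p} (c : Form p) m → ⟦ c ⊛^ m ⟧ x y ≡ ⟦ c ⟧ x y ^ m
  ⟦⊛^⟧ c zero    = refl
  ⟦⊛^⟧ c (suc m) = trans (⟦⊛⟧ c (c ⊛^ m)) (cong (⟦ c ⟧ x y *_) (⟦⊛^⟧ c m))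

-- Congruences

infix 4 _≡_mod_

record _≡_mod_ (a b m : ℤ) : Set where
  constructor congruent
  field
    quotient : ℤ
    a≡b+q*m  : a ≡ b + quotient * m

module _ {m : ℤ} where

  ≡⇒≡mod : ∀ {a b} → a ≡ b → a ≡ b mod m
  ≡⇒≡mod {a} refl = congruent 0ℤ (sym (ℤ.+-identityʳ a))

  ≡mod-refl : ∀ a → a ≡ a mod m
  ≡mod-refl a = ≡⇒≡mod refl

  ≡mod-sym : ∀ {a b} → a ≡ b mod m → b ≡ a mod m
  ≡mod-sym {a} {b} (congruent k refl) = congruent (- k) (rearrange b k m)
    where
    rearrange : ∀ b k m → b ≡ (b + k * m) + - k * m
    rearrange = solve-∀

  ≡mod-trans : ∀ {a b c} → a ≡ b mod m → b ≡ c mod m → a ≡ c mod m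
  ≡mod-trans {c = c} (congruent k refl) (congruent l refl) = congruent (l + k) (rearrange c l k m)
    where
    rearrange : ∀ c l k m → (c + l * m) + k * m ≡ c + (l + k) * m
    rearrange = solve-∀

  +-cong-mod : ∀ {a b c d} → a ≡ b mod m → c ≡ d mod m → a + c ≡ b + d mod m
  +-cong-mod {b = b} {d = d} (congruent k refl) (congruent l refl) = congruent (k + l) (rearrange b d k l m)
    where
    rearrange : ∀ b d k l m → (b + k * m) + (d + l * m) ≡ (b + d) + (k + l) * m
    rearrange = solve-∀

  *-cong-mod : ∀ {a b c d} → a ≡ b mod m → c ≡ d mod m → a * c ≡ b * d mod m
  *-cong-mod {b = b} {d = d} (congruent k refl) (congruent l refl) =
    congruent (k * d + b * l + k * l * m) (rearrange b d k l m)
    where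
    rearrange : ∀ b d k l m → (b + k * m) * (d + l * m) ≡ b * d + (k * d + b * l + k * l * m) * m
    rearrange = solve-∀

  ^-cong-mod : ∀ {a b} → a ≡ b mod m → ∀ k → a ^ k ≡ b ^ k mod m
  ^-cong-mod a≡b zero    = ≡mod-refl 1ℤ
  ^-cong-mod a≡b (suc k) = *-cong-mod a≡b (^-cong-mod a≡b k)

  ≡mod-setoid : Setoid 0ℓ 0ℓ
  ≡mod-setoid = record
    { Carrier       = ℤ
    ; _≈_           = _≡_mod m
    ; isEquivalence = record { refl = ≡mod-refl _ ; sym = ≡mod-sym ; trans = ≡mod-trans }
    }

m≡0-mod-m : ∀ m → m ≡ 0ℤ mod m
m≡0-mod-m m = congruent 1ℤ (rearrange m)
  where
  rearrange : ∀ m → m ≡ 0ℤ + 1ℤ * m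
  rearrange = solve-∀

≡0-mod-small : ∀ {a n} → a ≡ 0ℤ mod + n → ∣ a ∣ < n → a ≡ 0ℤ
≡0-mod-small {a} {n} (congruent k a≡kn) ∣a∣<n =
  ℤ.∣i∣≡0⇒i≡0 (trans ∣a∣≡∣k∣*n (cong (ℕ._* n) ∣k∣≡0))
  where
  ∣a∣≡∣k∣*n : ∣ a ∣ ≡ ∣ k ∣ ℕ.* n
  ∣a∣≡∣k∣*n = trans (cong ∣_∣ (trans a≡kn (ℤ.+-identityˡ (k * + n)))) (ℤ.abs-* k (+ n))
  ∣k∣≡0 : ∣ k ∣ ≡ 0
  ∣k∣≡0 = ℕ.n<1⇒n≡0 (ℕ.*-cancelʳ-< n ∣ k ∣ 1
            (subst₂ _<_ ∣a∣≡∣k∣*n (sym (ℕ.*-identityˡ n)) ∣a∣<n))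

⟦⟧-≡-head-mod : ∀ {p m x y y′} (c : Form p) → x ≡ 0ℤ mod m → y ≡ y′ mod m →
                ⟦ c ⟧ x y ≡ head c * y′ ^ p mod m
⟦⟧-≡-head-mod {zero}  c x≡0 y≡y′ = ≡⇒≡mod (sym (ℤ.*-identityʳ (head c)))
⟦⟧-≡-head-mod {suc p} {m} {x} {y} {y′} c x≡0 y≡y′ = begin
  head c * y ^ suc p + x * ⟦ tail c ⟧ x y
    ≈⟨ +-cong-mod (*-cong-mod (≡mod-refl (head c)) (^-cong-mod y≡y′ (suc p)))
                  (*-cong-mod x≡0 (≡mod-refl (⟦ tail c ⟧ x y))) ⟩
  head c * y′ ^ suc p + 0ℤ
    ≡⟨ ℤ.+-identityʳ (head c * y′ ^ suc p) ⟩
  head c * y′ ^ suc p ∎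
  where open ≈-Reasoning (≡mod-setoid {m})

-- Fibonacci numbers modulo F n

F : ℕ → ℤ
F n = + fib n

F-suc-suc : ∀ n → F (suc (suc n)) ≡ F (suc n) + F n
F-suc-suc n = ℤ.pos-+ (fib (suc n)) (fib n)

fib-+ : ∀ m n → fib (suc (m ℕ.+ n)) ≡ fib (suc m) ℕ.* fib (suc n) ℕ.+ fib m ℕ.* fib n
fib-+ zero    n = sym (trans (ℕ.+-identityʳ _) (ℕ.+-identityʳ (fib (suc n))))
fib-+ (suc m) n = begin
  fib (suc (suc m ℕ.+ n))                                   ≡⟨ cong (fib ∘ suc) (ℕ.+-suc m n) ⟨
  fib (suc (m ℕ.+ suc n))                                   ≡⟨ fib-+ m (suc n) ⟩
  fib (suc m) ℕ.* fib (suc (suc n)) ℕ.+ fib m ℕ.* fib (suc n) ≡⟨ rearrange (fib (suc m)) (fib m) (fib (suc n)) (fib n) ⟩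
  fib (suc (suc m)) ℕ.* fib (suc n) ℕ.+ fib (suc m) ℕ.* fib n ∎
  where
  open ≡-Reasoning
  rearrange : ∀ a b c d → a ℕ.* (c ℕ.+ d) ℕ.+ b ℕ.* c ≡ (a ℕ.+ b) ℕ.* c ℕ.+ a ℕ.* d
  rearrange = ℕ-solve-∀

F-shift : ∀ j n → F (j ℕ.+ n) ≡ F j * F (suc n) mod F n
F-shift zero    n = m≡0-mod-m (F n)
F-shift (suc j) n = congruent (F j) (begin
  + fib (suc (j ℕ.+ n))                                   ≡⟨ cong +_ (fib-+ j n) ⟩
  + (fib (suc j) ℕ.* fib (suc n) ℕ.+ fib j ℕ.* fib n)
    ≡⟨ ℤ.pos-+ (fib (suc j) ℕ.* fib (suc n)) (fib j ℕ.* fib n) ⟩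
  + (fib (suc j) ℕ.* fib (suc n)) + + (fib j ℕ.* fib n)
    ≡⟨ cong₂ _+_ (ℤ.pos-* (fib (suc j)) (fib (suc n))) (ℤ.pos-* (fib j) (fib n)) ⟩
  F (suc j) * F (suc n) + F j * F n                       ∎)
  where open ≡-Reasoning

F-+-* : ∀ j k n → F (j ℕ.+ k ℕ.* n) ≡ F j * F (suc n) ^ k mod F n
F-+-* j zero    n = ≡⇒≡mod (trans (cong F (ℕ.+-identityʳ j)) (sym (ℤ.*-identityʳ (F j))))
F-+-* j (suc k) n = begin
  F (j ℕ.+ (n ℕ.+ k ℕ.* n))            ≡⟨ cong F (reindex j n (k ℕ.* n)) ⟩
  F ((j ℕ.+ k ℕ.* n) ℕ.+ n)            ≈⟨ F-shift (j ℕ.+ k ℕ.* n) n ⟩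
  F (j ℕ.+ k ℕ.* n) * s                ≈⟨ *-cong-mod (F-+-* j k n) (≡mod-refl s) ⟩
  F j * s ^ k * s                      ≡⟨ rearrange (F j) s (s ^ k) ⟩
  F j * s ^ suc k                      ∎
  where
  s : ℤ
  s = F (suc n)
  open ≈-Reasoning (≡mod-setoid {F n})
  reindex : ∀ j n m → j ℕ.+ (n ℕ.+ m) ≡ (j ℕ.+ m) ℕ.+ n
  reindex = ℕ-solve-∀
  rearrange : ∀ a s t → a * t * s ≡ a * (s * t)
  rearrange = solve-∀

F-*≡0 : ∀ k n → F (k ℕ.* n) ≡ 0ℤ mod F n
F-*≡0 = F-+-* 0

F-suc-*≡^ : ∀ k n → F (suc (k ℕ.* n)) ≡ F (suc n) ^ k mod F n
F-suc-*≡^ k n = ≡mod-trans (F-+-* 1 k n) (≡⇒≡mod (ℤ.*-identityˡ (F (suc n) ^ k)))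

cassini : ∀ n → F (suc n) ^ 2 - F n * F (suc n) - F n ^ 2 ≡ -1ℤ ^ n
cassini zero    = refl
cassini (suc n) = begin
  F (suc (suc n)) ^ 2 - F (suc n) * F (suc (suc n)) - F (suc n) ^ 2
    ≡⟨ cong (λ z → z ^ 2 - F (suc n) * z - F (suc n) ^ 2) (F-suc-suc n) ⟩
  (F (suc n) + F n) ^ 2 - F (suc n) * (F (suc n) + F n) - F (suc n) ^ 2
    ≡⟨ rearrange (F n) (F (suc n)) ⟩
  -1ℤ * (F (suc n) ^ 2 - F n * F (suc n) - F n ^ 2)
    ≡⟨ cong (-1ℤ *_) (cassini n) ⟩
  -1ℤ ^ suc n ∎
  where
  open ≡-Reasoning
  rearrange : ∀ x y → (y + x) * ((y + x) * 1ℤ) - y * (y + x) - y * (y * 1ℤ)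
                  ≡ -1ℤ * (y * (y * 1ℤ) - x * y - x * (x * 1ℤ))
  rearrange = solve-∀

F-suc²≡±1 : ∀ n → F (suc n) ^ 2 ≡ -1ℤ ^ n mod F n
F-suc²≡±1 n = congruent (F (suc n) + F n) (begin
  y ^ 2                                  ≡⟨ rearrange x y ⟩
  (y ^ 2 - x * y - x ^ 2) + (y + x) * x  ≡⟨ cong (_+ (y + x) * x) (cassini n) ⟩
  -1ℤ ^ n + (y + x) * x                  ∎)
  where
  x y : ℤ
  x = F n
  y = F (suc n)
  open ≡-Reasoning
  rearrange : ∀ x y → y * (y * 1ℤ) ≡ (y * (y * 1ℤ) - x * y - x * (x * 1ℤ)) + (y + x) * x
  rearrange = solve-∀

-1^n*-1^n≡1 : ∀ n → -1ℤ ^ n * -1ℤ ^ n ≡ 1ℤ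
-1^n*-1^n≡1 zero    = refl
-1^n*-1^n≡1 (suc n) = trans (rearrange (-1ℤ ^ n)) (-1^n*-1^n≡1 n)
  where
  rearrange : ∀ a → -1ℤ * a * (-1ℤ * a) ≡ a * a
  rearrange = solve-∀

-1^odd≡-1 : ∀ t → -1ℤ ^ suc (t ℕ.+ t) ≡ -1ℤ
-1^odd≡-1 t = cong (-1ℤ *_) (trans (ℤ.^-distribˡ-+-* -1ℤ t t) (-1^n*-1^n≡1 t))

F-suc⁴≡1 : ∀ n → F (suc n) ^ 4 ≡ 1ℤ mod F n
F-suc⁴≡1 n = begin
  F (suc n) ^ 4                     ≡⟨ ℤ.^-distribˡ-+-* (F (suc n)) 2 2 ⟩
  F (suc n) ^ 2 * F (suc n) ^ 2     ≈⟨ *-cong-mod (F-suc²≡±1 n) (F-suc²≡±1 n) ⟩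
  -1ℤ ^ n * -1ℤ ^ n                 ≡⟨ -1^n*-1^n≡1 n ⟩
  1ℤ                                ∎
  where open ≈-Reasoning (≡mod-setoid {F n})

F-suc²≡-1 : ∀ t → let n = suc (t ℕ.+ t) in F (suc n) ^ 2 ≡ -1ℤ mod F n
F-suc²≡-1 t = ≡mod-trans (F-suc²≡±1 (suc (t ℕ.+ t))) (≡⇒≡mod (-1^odd≡-1 t))

1≤fib[1+n] : ∀ n → 1 ≤ fib (suc n)
1≤fib[1+n] zero    = ℕ.≤-refl
1≤fib[1+n] (suc n) = ℕ.≤-trans (1≤fib[1+n] n) (ℕ.m≤m+n (fib (suc n)) (fib n))

n≤fib[1+n] : ∀ n → n ≤ fib (suc n)
n≤fib[1+n] zero          = ℕ.z≤n
n≤fib[1+n] (suc zero)    = ℕ.≤-refl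
n≤fib[1+n] (suc (suc n)) =
  subst (_≤ fib (suc (suc (suc n)))) (ℕ.+-comm (suc n) 1) (ℕ.+-mono-≤ (n≤fib[1+n] (suc n)) (1≤fib[1+n] n))

F[1+n]≢0 : ∀ n → F (suc n) ≢ 0ℤ
F[1+n]≢0 n F≡0 = ℕ.<⇒≢ (1≤fib[1+n] n) (sym (ℤ.+-injective F≡0))

fib-odd-superlinear : ∀ K → ∃ λ t → K ℕ.* suc (t ℕ.+ t) < fib (suc (t ℕ.+ t))
fib-odd-superlinear K = t , (begin-strict
  K ℕ.* suc (t ℕ.+ t)                                  <⟨ ℕ.m<m+n (K ℕ.* suc (t ℕ.+ t)) (ℕ.s≤s ℕ.z≤n) ⟩
  K ℕ.* suc (t ℕ.+ t) ℕ.+ suc (3 ℕ.+ 3 ℕ.* K)           ≡⟨ rearrange K ⟩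
  t ℕ.* t                                              ≤⟨ ℕ.*-mono-≤ (n≤fib[1+n] t) (n≤fib[1+n] t) ⟩
  fib (suc t) ℕ.* fib (suc t)                          ≤⟨ ℕ.m≤m+n _ (fib t ℕ.* fib t) ⟩
  fib (suc t) ℕ.* fib (suc t) ℕ.+ fib t ℕ.* fib t      ≡⟨ fib-+ t t ⟨
  fib (suc (t ℕ.+ t))                                  ∎)
  where
  t : ℕ
  t = 2 ℕ.+ (K ℕ.+ K)
  open ℕ.≤-Reasoning
  rearrange : ∀ K → K ℕ.* suc ((2 ℕ.+ (K ℕ.+ K)) ℕ.+ (2 ℕ.+ (K ℕ.+ K))) ℕ.+ suc (3 ℕ.+ 3 ℕ.* K)
              ≡ (2 ℕ.+ (K ℕ.+ K)) ℕ.* (2 ℕ.+ (K ℕ.+ K))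
  rearrange = ℕ-solve-∀

≡0-mod-F⇒≡0 : ∀ a → (∀ t → let n = suc (t ℕ.+ t) in a * + n ≡ 0ℤ mod F n) → a ≡ 0ℤ
≡0-mod-F⇒≡0 a an≡0 = a≡0 (fib-odd-superlinear ∣ a ∣)
  where
  a≡0 : ∃ (λ t → ∣ a ∣ ℕ.* suc (t ℕ.+ t) < fib (suc (t ℕ.+ t))) → a ≡ 0ℤ
  a≡0 (t , ∣a∣n<Fn) = [ id , (λ ()) ]′ (ℤ.i*j≡0⇒i≡0∨j≡0 a (≡0-mod-small (an≡0 t) ∣an∣<Fn))
    where
    ∣an∣<Fn : ∣ a * + suc (t ℕ.+ t) ∣ < fib (suc (t ℕ.+ t))
    ∣an∣<Fn = subst (_< fib (suc (t ℕ.+ t))) (sym (ℤ.abs-* a (+ suc (t ℕ.+ t)))) ∣a∣n<Fn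

-- Forms at the points (F n, F (n + 1))

⟦⟧-at-F0 : ∀ {p} (c : Form p) → ⟦ c ⟧ (F 0) (F 1) ≡ head c
⟦⟧-at-F0 {zero}  c = refl
⟦⟧-at-F0 {suc p} c = begin
  head c * 1ℤ ^ suc p + 0ℤ  ≡⟨ ℤ.+-identityʳ (head c * 1ℤ ^ suc p) ⟩
  head c * 1ℤ ^ suc p       ≡⟨ cong (head c *_) (ℤ.^-zeroˡ (suc p)) ⟩
  head c * 1ℤ               ≡⟨ ℤ.*-identityʳ (head c) ⟩
  head c                    ∎
  where open ≡-Reasoning

⟦⟧-at-F-4* : ∀ {p} (c : Form p) n → ⟦ c ⟧ (F (4 ℕ.* n)) (F (suc (4 ℕ.* n))) ≡ head c mod F n
⟦⟧-at-F-4* {p} c n = begin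
  ⟦ c ⟧ (F (4 ℕ.* n)) (F (suc (4 ℕ.* n)))  ≈⟨ ⟦⟧-≡-head-mod c (F-*≡0 4 n) (F-suc-*≡^ 4 n) ⟩
  head c * (F (suc n) ^ 4) ^ p              ≈⟨ *-cong-mod (≡mod-refl (head c)) (^-cong-mod (F-suc⁴≡1 n) p) ⟩
  head c * 1ℤ ^ p                           ≡⟨ cong (head c *_) (ℤ.^-zeroˡ p) ⟩
  head c * 1ℤ                               ≡⟨ ℤ.*-identityʳ (head c) ⟩
  head c                                    ∎
  where open ≈-Reasoning (≡mod-setoid {F n})

⟦⟧-at-F-odd : ∀ {p k u} (c : Form p) → k ℕ.* p ≡ 2 ℕ.* suc (u ℕ.+ u) →
              ∀ t → let n = suc (t ℕ.+ t) in ⟦ c ⟧ (F (k ℕ.* n)) (F (suc (k ℕ.* n))) ≡ - head c mod F n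
⟦⟧-at-F-odd {p} {k} {u} c kp≡2m t = begin
  ⟦ c ⟧ (F (k ℕ.* n)) (F (suc (k ℕ.* n)))  ≈⟨ ⟦⟧-≡-head-mod c (F-*≡0 k n) (F-suc-*≡^ k n) ⟩
  head c * (s ^ k) ^ p                      ≡⟨ cong (head c *_) s^kp≡ ⟩
  head c * (s ^ 2) ^ m                      ≈⟨ *-cong-mod (≡mod-refl (head c)) (^-cong-mod (F-suc²≡-1 t) m) ⟩
  head c * -1ℤ ^ m                          ≡⟨ cong (head c *_) (-1^odd≡-1 u) ⟩
  head c * -1ℤ                              ≡⟨ rearrange (head c) ⟩
  - head c                                  ∎
  where
  n : ℕ
  n = suc (t ℕ.+ t)
  s : ℤ
  s = F (suc n)
  m : ℕ
  m = suc (u ℕ.+ u)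
  open ≈-Reasoning (≡mod-setoid {F n})
  s^kp≡ : (s ^ k) ^ p ≡ (s ^ 2) ^ m
  s^kp≡ = trans (ℤ.^-*-assoc s k p) (trans (cong (s ^_) kp≡2m) (sym (ℤ.^-*-assoc s 2 m)))
  rearrange : ∀ a → a * -1ℤ ≡ - a
  rearrange = solve-∀

-- Only n ≥ 1: the induction on the degree divides by x = F n.
VanishesOnF : ∀ {p} → Form p → Set
VanishesOnF c = ∀ n → ⟦ c ⟧ (F (suc n)) (F (suc (suc n))) ≡ 0ℤ

vanishes⇒head≡0 : ∀ {p} (c : Form p) → VanishesOnF c → head c ≡ 0ℤ
vanishes⇒head≡0 c c≡0 = ≡0-mod-F⇒≡0 (head c) head*n≡0
  where
  head*n≡0 : ∀ t → head c * + suc (t ℕ.+ t) ≡ 0ℤ mod F (suc (t ℕ.+ t))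
  head*n≡0 t = begin
    head c * + n                                   ≈⟨ *-cong-mod (≡mod-sym (⟦⟧-at-F-4* c n)) (≡mod-refl (+ n)) ⟩
    ⟦ c ⟧ (F (4 ℕ.* n)) (F (suc (4 ℕ.* n))) * + n   ≡⟨ cong (_* + n) (c≡0 (t ℕ.+ t ℕ.+ 3 ℕ.* n)) ⟩
    0ℤ                                             ∎
    where
    n : ℕ
    n = suc (t ℕ.+ t)
    open ≈-Reasoning (≡mod-setoid {F n})

tail-vanishes : ∀ {p} (c : Form (suc p)) → VanishesOnF c → VanishesOnF (tail c)
tail-vanishes {p} c c≡0 n = [ ⊥-elim ∘ F[1+n]≢0 n , id ]′ (ℤ.i*j≡0⇒i≡0∨j≡0 x (begin
  x * ⟦ tail c ⟧ x y                     ≡⟨ ℤ.+-identityˡ (x * ⟦ tail c ⟧ x y) ⟨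
  0ℤ * y ^ suc p + x * ⟦ tail c ⟧ x y
    ≡⟨ cong (λ h → h * y ^ suc p + x * ⟦ tail c ⟧ x y) (vanishes⇒head≡0 c c≡0) ⟨
  ⟦ c ⟧ x y                              ≡⟨ c≡0 n ⟩
  0ℤ                                     ∎))
  where
  x y : ℤ
  x = F (suc n)
  y = F (suc (suc n))
  open ≡-Reasoning

vanishes⇒≡0 : ∀ {p} (c : Form p) → VanishesOnF c → ∀ i → c i ≡ 0ℤ
vanishes⇒≡0 {zero}  c c≡0 zero    = c≡0 0
vanishes⇒≡0 {suc p} c c≡0 zero    = vanishes⇒head≡0 c c≡0
vanishes⇒≡0 {suc p} c c≡0 (suc i) = vanishes⇒≡0 (tail c) (tail-vanishes c c≡0) i

¬4∣⇒k*p≡2*odd : ∀ p → ¬ 4 ∣ p → ∃₂ λ k u → k ℕ.* p ≡ 2 ℕ.* suc (u ℕ.+ u)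
¬4∣⇒k*p≡2*odd 0 ¬4∣p = ⊥-elim (¬4∣p (4 ∣0))
¬4∣⇒k*p≡2*odd 1 _ = 2 , 0 , refl
¬4∣⇒k*p≡2*odd 2 _ = 1 , 0 , refl
¬4∣⇒k*p≡2*odd 3 _ = 2 , 1 , refl
¬4∣⇒k*p≡2*odd (suc (suc (suc (suc p)))) ¬4∣4+p with ¬4∣⇒k*p≡2*odd p (¬4∣4+p ∘ ∣m∣n⇒∣m+n ∣-refl)
... | k , u , kp≡2m = k , u ℕ.+ k , (begin
  k ℕ.* (4 ℕ.+ p)                            ≡⟨ ℕ.*-distribˡ-+ k 4 p ⟩
  k ℕ.* 4 ℕ.+ k ℕ.* p                        ≡⟨ cong (k ℕ.* 4 ℕ.+_) kp≡2m ⟩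
  k ℕ.* 4 ℕ.+ 2 ℕ.* suc (u ℕ.+ u)            ≡⟨ rearrange k u ⟩
  2 ℕ.* suc ((u ℕ.+ k) ℕ.+ (u ℕ.+ k))        ∎)
  where
  open ≡-Reasoning
  rearrange : ∀ k u → k ℕ.* 4 ℕ.+ 2 ℕ.* suc (u ℕ.+ u) ≡ 2 ℕ.* suc ((u ℕ.+ k) ℕ.+ (u ℕ.+ k))
  rearrange = ℕ-solve-∀

i+i≡0⇒i≡0 : ∀ {i} → i + i ≡ 0ℤ → i ≡ 0ℤ
i+i≡0⇒i≡0 {+ zero} _ = refl

AffineRelation : ∀ {p} → ℤ → ℤ → Form p → Set
AffineRelation a b c = ∀ n → a * + n + (b + ⟦ c ⟧ (F n) (F (suc n))) ≡ 0ℤ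

module AffineRelationProperties {p} (a b : ℤ) (c : Form p) (rel : AffineRelation a b c) where

  affine-const+head≡0 : b + head c ≡ 0ℤ
  affine-const+head≡0 = begin
    b + head c                             ≡⟨ cong (_+_ b) (⟦⟧-at-F0 c) ⟨
    b + ⟦ c ⟧ (F 0) (F 1)                  ≡⟨ ℤ.+-identityˡ _ ⟨
    0ℤ + (b + ⟦ c ⟧ (F 0) (F 1))           ≡⟨ cong (_+ (b + ⟦ c ⟧ (F 0) (F 1))) (ℤ.*-zeroʳ a) ⟨
    a * + 0 + (b + ⟦ c ⟧ (F 0) (F 1))      ≡⟨ rel 0 ⟩
    0ℤ                                     ∎
    where open ≡-Reasoning

  affine-slope≡0 : a ≡ 0ℤ
  affine-slope≡0 = [ id , (λ ()) ]′ (ℤ.i*j≡0⇒i≡0∨j≡0 a (≡0-mod-F⇒≡0 (a * + 4) 4an≡0))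
    where
    4an≡0 : ∀ t → a * + 4 * + suc (t ℕ.+ t) ≡ 0ℤ mod F (suc (t ℕ.+ t))
    4an≡0 t = begin
      a * + 4 * + n                                     ≡⟨ ℤ.*-assoc a (+ 4) (+ n) ⟩
      a * + (4 ℕ.* n)                                   ≡⟨ ℤ.+-identityʳ (a * + (4 ℕ.* n)) ⟨
      a * + (4 ℕ.* n) + 0ℤ                              ≡⟨ cong (_+_ (a * + (4 ℕ.* n))) affine-const+head≡0 ⟨
      a * + (4 ℕ.* n) + (b + head c)
        ≈⟨ +-cong-mod (≡mod-refl (a * + (4 ℕ.* n))) (+-cong-mod (≡mod-refl b) (≡mod-sym (⟦⟧-at-F-4* c n))) ⟩
      a * + (4 ℕ.* n) + (b + ⟦ c ⟧ (F (4 ℕ.* n)) (F (suc (4 ℕ.* n))))  ≡⟨ rel (4 ℕ.* n) ⟩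
      0ℤ                                                ∎
      where
      n : ℕ
      n = suc (t ℕ.+ t)
      open ≈-Reasoning (≡mod-setoid {F n})

  affine-const+form≡0 : ∀ n → b + ⟦ c ⟧ (F n) (F (suc n)) ≡ 0ℤ
  affine-const+form≡0 n = begin
    b + ⟦ c ⟧ (F n) (F (suc n))               ≡⟨ ℤ.+-identityˡ _ ⟨
    0ℤ * + n + (b + ⟦ c ⟧ (F n) (F (suc n)))
      ≡⟨ cong (λ a → a * + n + (b + ⟦ c ⟧ (F n) (F (suc n)))) affine-slope≡0 ⟨
    a * + n + (b + ⟦ c ⟧ (F n) (F (suc n)))   ≡⟨ rel n ⟩
    0ℤ                                        ∎
    where open ≡-Reasoning

  affine-form≡head : ∀ n → ⟦ c ⟧ (F n) (F (suc n)) ≡ head c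
  affine-form≡head n = begin
    ⟦ c ⟧ (F n) (F (suc n))                           ≡⟨ rearrange b (⟦ c ⟧ (F n) (F (suc n))) (head c) ⟩
    (b + ⟦ c ⟧ (F n) (F (suc n))) - (b + head c) + head c
      ≡⟨ cong₂ (λ l r → l - r + head c) (affine-const+form≡0 n) affine-const+head≡0 ⟩
    0ℤ - 0ℤ + head c                                  ≡⟨ ℤ.+-identityˡ (head c) ⟩
    head c                                            ∎
    where
    open ≡-Reasoning
    rearrange : ∀ b T h → T ≡ (b + T) - (b + h) + h
    rearrange = solve-∀

  affine-const≡0 : ¬ 4 ∣ p → b ≡ 0ℤ
  affine-const≡0 ¬4∣p with ¬4∣⇒k*p≡2*odd p ¬4∣p
  ... | k , u , kp≡2m = trans (sym (ℤ.+-identityʳ b)) (trans (cong (_+_ b) (sym head≡0)) affine-const+head≡0)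
    where
    2hn≡0 : ∀ t → (head c + head c) * + suc (t ℕ.+ t) ≡ 0ℤ mod F (suc (t ℕ.+ t))
    2hn≡0 t = *-cong-mod {c = + n} (begin
      head c + head c                                     ≡⟨ cong (_+ head c) (affine-form≡head (k ℕ.* n)) ⟨
      ⟦ c ⟧ (F (k ℕ.* n)) (F (suc (k ℕ.* n))) + head c
        ≈⟨ +-cong-mod (⟦⟧-at-F-odd {k = k} {u} c kp≡2m t) (≡mod-refl (head c)) ⟩
      - head c + head c                                   ≡⟨ ℤ.+-inverseˡ (head c) ⟩
      0ℤ                                                  ∎) (≡mod-refl (+ n))
      where
      n : ℕ
      n = suc (t ℕ.+ t)
      open ≈-Reasoning (≡mod-setoid {F n})
    head≡0 : head c ≡ 0ℤ
    head≡0 = i+i≡0⇒i≡0 (≡0-mod-F⇒≡0 (head c + head c) 2hn≡0)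

cassini-form : Form 2
cassini-form = 1ℤ ∷ -1ℤ ∷ -1ℤ ∷ []

⟦cassini-form⟧ : ∀ x y → ⟦ cassini-form ⟧ x y ≡ y ^ 2 - x * y - x ^ 2
⟦cassini-form⟧ = rearrange
  where
  rearrange : ∀ x y → 1ℤ * (y * (y * 1ℤ)) + x * (-1ℤ * (y * 1ℤ) + x * -1ℤ) ≡ y * (y * 1ℤ) - x * y - x * (x * 1ℤ)
  rearrange = solve-∀

unit-form : ∀ q → Form (q ℕ.* 4)
unit-form q = (cassini-form ⊛ cassini-form) ⊛^ q

⟦unit-form⟧ : ∀ q n → ⟦ unit-form q ⟧ (F n) (F (suc n)) ≡ 1ℤ
⟦unit-form⟧ q n = begin
  ⟦ (cassini-form ⊛ cassini-form) ⊛^ q ⟧ x y    ≡⟨ ⟦⊛^⟧ x y (cassini-form ⊛ cassini-form) q ⟩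
  ⟦ cassini-form ⊛ cassini-form ⟧ x y ^ q       ≡⟨ cong (_^ q) (⟦⊛⟧ x y cassini-form cassini-form) ⟩
  (⟦ cassini-form ⟧ x y * ⟦ cassini-form ⟧ x y) ^ q
    ≡⟨ cong (λ z → (z * z) ^ q) (trans (⟦cassini-form⟧ x y) (cassini n)) ⟩
  (-1ℤ ^ n * -1ℤ ^ n) ^ q                       ≡⟨ cong (_^ q) (-1^n*-1^n≡1 n) ⟩
  1ℤ ^ q                                        ≡⟨ ℤ.^-zeroˡ q ⟩
  1ℤ                                            ∎
  where
  x y : ℤ
  x = F n
  y = F (suc n)
  open ≡-Reasoning

-- Clearing denominators

-- ℕ→ℚ k is definitionally ι (+ k).
ι : ℤ → ℚ
ι i = i / 1

toℚᵘ-ι : ∀ i → toℚᵘ (ι i) ℚᵘ.≃ mkℚᵘ i 0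
toℚᵘ-ι i = ℚ.toℚᵘ-fromℚᵘ (mkℚᵘ i 0)

ι-+ : ∀ i j → ι (i + j) ≡ ι i ℚ.+ ι j
ι-+ i j = ℚ.toℚᵘ-injective (begin
  toℚᵘ (ι (i + j))             ≈⟨ toℚᵘ-ι (i + j) ⟩
  mkℚᵘ (i + j) 0               ≈⟨ *≡* (rearrange i j) ⟩
  mkℚᵘ i 0 ℚᵘ.+ mkℚᵘ j 0       ≈⟨ ℚᵘ.+-cong (toℚᵘ-ι i) (toℚᵘ-ι j) ⟨
  toℚᵘ (ι i) ℚᵘ.+ toℚᵘ (ι j)   ≈⟨ ℚ.toℚᵘ-homo-+ (ι i) (ι j) ⟨
  toℚᵘ (ι i ℚ.+ ι j)           ∎)
  where
  open ℚᵘ.≃-Reasoning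
  rearrange : ∀ i j → (i + j) * (+ 1 * + 1) ≡ (i * + 1 + j * + 1) * + 1
  rearrange = solve-∀

ι-* : ∀ i j → ι (i * j) ≡ ι i ℚ.* ι j
ι-* i j = ℚ.toℚᵘ-injective (begin
  toℚᵘ (ι (i * j))             ≈⟨ toℚᵘ-ι (i * j) ⟩
  mkℚᵘ (i * j) 0               ≈⟨ *≡* (rearrange i j) ⟩
  mkℚᵘ i 0 ℚᵘ.* mkℚᵘ j 0       ≈⟨ ℚᵘ.*-cong (toℚᵘ-ι i) (toℚᵘ-ι j) ⟨
  toℚᵘ (ι i) ℚᵘ.* toℚᵘ (ι j)   ≈⟨ ℚ.toℚᵘ-homo-* (ι i) (ι j) ⟨
  toℚᵘ (ι i ℚ.* ι j)           ∎)
  where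
  open ℚᵘ.≃-Reasoning
  rearrange : ∀ i j → (i * j) * (+ 1 * + 1) ≡ (i * j) * + 1
  rearrange = solve-∀

ι-injective : ∀ {i j} → ι i ≡ ι j → i ≡ j
ι-injective {i} {j} ιi≡ιj
  with ℚᵘ.≃-trans (ℚᵘ.≃-sym (toℚᵘ-ι i)) (ℚᵘ.≃-trans (ℚ.toℚᵘ-cong ιi≡ιj) (toℚᵘ-ι j))
... | *≡* i*1≡j*1 = trans (sym (ℤ.*-identityʳ i)) (trans i*1≡j*1 (ℤ.*-identityʳ j))

ι-↥ : ∀ r → ι (↥ r) ≡ ι (↧ r) ℚ.* r
ι-↥ r@record{} = ℚ.toℚᵘ-injective (begin
  toℚᵘ (ι (↥ r))               ≈⟨ toℚᵘ-ι (↥ r) ⟩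
  mkℚᵘ (↥ r) 0
    ≈⟨ *≡* (trans (cong (λ k → ↥ r * + k) (ℕ.*-identityˡ (ℚ.↧ₙ r))) (rearrange (↥ r) (↧ r))) ⟩
  mkℚᵘ (↧ r) 0 ℚᵘ.* toℚᵘ r     ≈⟨ ℚᵘ.*-congʳ (toℚᵘ-ι (↧ r)) ⟨
  toℚᵘ (ι (↧ r)) ℚᵘ.* toℚᵘ r   ≈⟨ ℚ.toℚᵘ-homo-* (ι (↧ r)) r ⟨
  toℚᵘ (ι (↧ r) ℚ.* r)         ∎)
  where
  open ℚᵘ.≃-Reasoning
  rearrange : ∀ a b → a * b ≡ (b * a) * + 1
  rearrange = solve-∀

*-cancelˡ-≢0 : ∀ {s x y} → s ≢ 0ℚ → s ℚ.* x ≡ s ℚ.* y → x ≡ y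
*-cancelˡ-≢0 {s} {x} {y} s≢0 sx≡sy = begin
  x                    ≡⟨ cancel x ⟩
  1/ s ℚ.* (s ℚ.* x)   ≡⟨ cong (1/ s ℚ.*_) sx≡sy ⟩
  1/ s ℚ.* (s ℚ.* y)   ≡⟨ cancel y ⟨
  y                    ∎
  where
  open ≡-Reasoning
  instance _ = ℚ.≢-nonZero s≢0
  cancel : ∀ z → z ≡ 1/ s ℚ.* (s ℚ.* z)
  cancel z = sym (begin
    1/ s ℚ.* (s ℚ.* z)   ≡⟨ ℚ.*-assoc (1/ s) s z ⟨
    1/ s ℚ.* s ℚ.* z     ≡⟨ cong (ℚ._* z) (ℚ.*-inverseˡ s) ⟩
    1ℚ ℚ.* z             ≡⟨ ℚ.*-identityˡ z ⟩
    z                    ∎)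

record Cleared {m} (d : Vector ℚ m) : Set where
  field
    scale       : ℤ
    scale≢0     : scale ≢ 0ℤ
    numerator   : Vector ℤ m
    ι-numerator : ∀ j → ι (numerator j) ≡ ι scale ℚ.* d j

  ι-scale≢0 : ι scale ≢ 0ℚ
  ι-scale≢0 = scale≢0 ∘ ι-injective

  numerator≡0⇒≡0 : (∀ j → numerator j ≡ 0ℤ) → ∀ j → d j ≡ 0ℚ
  numerator≡0⇒≡0 z≡0 j = *-cancelˡ-≢0 ι-scale≢0 (begin
    ι scale ℚ.* d j    ≡⟨ ι-numerator j ⟨
    ι (numerator j)    ≡⟨ cong ι (z≡0 j) ⟩
    0ℚ                 ≡⟨ ℚ.*-zeroʳ (ι scale) ⟨
    ι scale ℚ.* 0ℚ     ∎)
    where open ≡-Reasoning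

  numerator≡*⇒≡* : ∀ i (w : Vector ℤ m) → (∀ j → numerator j ≡ numerator i * w j) →
                   ∀ j → d j ≡ d i ℚ.* ι (w j)
  numerator≡*⇒≡* i w z≡zw j = *-cancelˡ-≢0 ι-scale≢0 (begin
    ι scale ℚ.* d j                   ≡⟨ ι-numerator j ⟨
    ι (numerator j)                   ≡⟨ cong ι (z≡zw j) ⟩
    ι (numerator i * w j)             ≡⟨ ι-* (numerator i) (w j) ⟩
    ι (numerator i) ℚ.* ι (w j)       ≡⟨ cong (ℚ._* ι (w j)) (ι-numerator i) ⟩
    ι scale ℚ.* d i ℚ.* ι (w j)       ≡⟨ ℚ.*-assoc (ι scale) (d i) (ι (w j)) ⟩
    ι scale ℚ.* (d i ℚ.* ι (w j))     ∎)
    where open ≡-Reasoning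

clear-denominators : ∀ {m} (d : Vector ℚ m) → Cleared d
clear-denominators {zero}  d = record { scale = 1ℤ ; scale≢0 = λ () ; numerator = [] ; ι-numerator = λ () }
clear-denominators {suc m} d = record
  { scale       = ↧ r * S
  ; scale≢0     = [ (λ ()) , S≢0 ]′ ∘ ℤ.i*j≡0⇒i≡0∨j≡0 (↧ r)
  ; numerator   = ↥ r * S ∷ map (↧ r *_) z
  ; ι-numerator = λ { zero → ι-head ; (suc j) → ι-tail j }
  }
  where
  r : ℚ
  r = head d
  open Cleared (clear-denominators (tail d)) renaming (scale to S; scale≢0 to S≢0; numerator to z; ι-numerator to ι-z)
  open ≡-Reasoning
  ι-head : ι (↥ r * S) ≡ ι (↧ r * S) ℚ.* r
  ι-head = begin
    ι (↥ r * S)                 ≡⟨ ι-* (↥ r) S ⟩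
    ι (↥ r) ℚ.* ι S             ≡⟨ cong (ℚ._* ι S) (ι-↥ r) ⟩
    ι (↧ r) ℚ.* r ℚ.* ι S       ≡⟨ xy∙z≈xz∙y (ι (↧ r)) r (ι S) ⟩
    ι (↧ r) ℚ.* ι S ℚ.* r       ≡⟨ cong (ℚ._* r) (ι-* (↧ r) S) ⟨
    ι (↧ r * S) ℚ.* r           ∎
  ι-tail : ∀ j → ι (↧ r * z j) ≡ ι (↧ r * S) ℚ.* tail d j
  ι-tail j = begin
    ι (↧ r * z j)               ≡⟨ ι-* (↧ r) (z j) ⟩
    ι (↧ r) ℚ.* ι (z j)         ≡⟨ cong (ι (↧ r) ℚ.*_) (ι-z j) ⟩
    ι (↧ r) ℚ.* (ι S ℚ.* tail d j)  ≡⟨ ℚ.*-assoc (ι (↧ r)) (ι S) (tail d j) ⟨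
    ι (↧ r) ℚ.* ι S ℚ.* tail d j    ≡⟨ cong (ℚ._* tail d j) (ι-* (↧ r) S) ⟨
    ι (↧ r * S) ℚ.* tail d j        ∎

∑-cong : ∀ {m} {g h : Vector ℚ m} → (∀ j → g j ≡ h j) → ∑ g ≡ ∑ h
∑-cong {zero}  g≡h = refl
∑-cong {suc m} g≡h = cong₂ ℚ._+_ (g≡h zero) (∑-cong (g≡h ∘ suc))

∑-*ˡ : ∀ {m} k (g : Vector ℚ m) → ∑ (λ j → k ℚ.* g j) ≡ k ℚ.* ∑ g
∑-*ˡ {zero}  k g = sym (ℚ.*-zeroʳ k)
∑-*ˡ {suc m} k g = trans (cong (k ℚ.* head g ℚ.+_) (∑-*ˡ k (tail g))) (sym (ℚ.*-distribˡ-+ k (head g) (∑ (tail g))))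

Cleared-relation : ∀ {m} (f : Fin m → ℕ → ℚ) {d} (cd : Cleared d) → IsRelation f d →
                   IsRelation f (ι ∘ Cleared.numerator cd)
Cleared-relation f {d} cd rel n = begin
  ∑ (λ j → ι (numerator j) ℚ.* f j n)          ≡⟨ ∑-cong (λ j → cong (ℚ._* f j n) (ι-numerator j)) ⟩
  ∑ (λ j → ι scale ℚ.* d j ℚ.* f j n)          ≡⟨ ∑-cong (λ j → ℚ.*-assoc (ι scale) (d j) (f j n)) ⟩
  ∑ (λ j → ι scale ℚ.* (d j ℚ.* f j n))        ≡⟨ ∑-*ˡ (ι scale) (λ j → d j ℚ.* f j n) ⟩
  ι scale ℚ.* ∑ (λ j → d j ℚ.* f j n)          ≡⟨ cong (ι scale ℚ.*_) (rel n) ⟩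
  ι scale ℚ.* 0ℚ                               ≡⟨ ℚ.*-zeroʳ (ι scale) ⟩
  0ℚ                                           ∎
  where
  open Cleared cd
  open ≡-Reasoning

pos-^ : ∀ a k → + (a ℕ.^ k) ≡ (+ a) ^ k
pos-^ a zero    = refl
pos-^ a (suc k) = trans (ℤ.pos-* a (a ℕ.^ k)) (cong (_*_ (+ a)) (pos-^ a k))

powFam-zero : ∀ p n → powFam p zero n ≡ ι (F (suc n) ^ p)
powFam-zero p n = cong ι (trans (cong +_ (ℕ.*-identityˡ (fib (suc n) ℕ.^ p))) (pos-^ (fib (suc n)) p))

powFam-suc : ∀ p j n → powFam (suc p) (suc j) n ≡ ι (F n) ℚ.* powFam p j n
powFam-suc p j n = begin
  ι (+ (fib n ℕ.* fib n ℕ.^ toℕ j ℕ.* Y))       ≡⟨ cong (ι ∘ +_) (ℕ.*-assoc (fib n) (fib n ℕ.^ toℕ j) Y) ⟩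
  ι (+ (fib n ℕ.* (fib n ℕ.^ toℕ j ℕ.* Y)))     ≡⟨ cong ι (ℤ.pos-* (fib n) (fib n ℕ.^ toℕ j ℕ.* Y)) ⟩
  ι (F n * + (fib n ℕ.^ toℕ j ℕ.* Y))           ≡⟨ ι-* (F n) (+ (fib n ℕ.^ toℕ j ℕ.* Y)) ⟩
  ι (F n) ℚ.* powFam p j n                      ∎
  where
  Y : ℕ
  Y = fib (suc n) ℕ.^ (p ∸ toℕ j)
  open ≡-Reasoning

powFam-∑ : ∀ p (c : Form p) n → ∑ (λ j → ι (c j) ℚ.* powFam p j n) ≡ ι (⟦ c ⟧ (F n) (F (suc n)))
powFam-∑ zero    c n = trans (ℚ.+-identityʳ (ι (head c) ℚ.* 1ℚ)) (ℚ.*-identityʳ (ι (head c)))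
powFam-∑ (suc p) c n = begin
  ι (head c) ℚ.* powFam (suc p) zero n ℚ.+ ∑ (λ j → ι (tail c j) ℚ.* powFam (suc p) (suc j) n)
    ≡⟨ cong₂ ℚ._+_ (cong (ι (head c) ℚ.*_) (powFam-zero (suc p) n))
                   (∑-cong λ j → trans (cong (ι (tail c j) ℚ.*_) (powFam-suc p j n))
                                       (x∙yz≈y∙xz (ι (tail c j)) (ι x) (powFam p j n))) ⟩
  ι (head c) ℚ.* ι (y ^ suc p) ℚ.+ ∑ (λ j → ι x ℚ.* (ι (tail c j) ℚ.* powFam p j n))
    ≡⟨ cong (ι (head c) ℚ.* ι (y ^ suc p) ℚ.+_) (∑-*ˡ (ι x) (λ j → ι (tail c j) ℚ.* powFam p j n)) ⟩
  ι (head c) ℚ.* ι (y ^ suc p) ℚ.+ ι x ℚ.* ∑ (λ j → ι (tail c j) ℚ.* powFam p j n)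
    ≡⟨ cong (λ t → ι (head c) ℚ.* ι (y ^ suc p) ℚ.+ ι x ℚ.* t) (powFam-∑ p (tail c) n) ⟩
  ι (head c) ℚ.* ι (y ^ suc p) ℚ.+ ι x ℚ.* ι (⟦ tail c ⟧ x y)
    ≡⟨ cong₂ ℚ._+_ (ι-* (head c) (y ^ suc p)) (ι-* x (⟦ tail c ⟧ x y)) ⟨
  ι (head c * y ^ suc p) ℚ.+ ι (x * ⟦ tail c ⟧ x y)
    ≡⟨ ι-+ (head c * y ^ suc p) (x * ⟦ tail c ⟧ x y) ⟨
  ι (⟦ c ⟧ x y) ∎
  where
  x y : ℤ
  x = F n
  y = F (suc n)
  open ≡-Reasoning

extFam-∑ : ∀ p (z : Vector ℤ (3 ℕ.+ p)) n →
           ∑ (λ j → ι (z j) ℚ.* extFam p j n)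
           ≡ ι (head z * + n + (head (tail z) + ⟦ tail (tail z) ⟧ (F n) (F (suc n))))
extFam-∑ p z n = begin
  ι z₀ ℚ.* ι (+ n) ℚ.+ (ι z₁ ℚ.* ι 1ℤ ℚ.+ ∑ (λ j → ι (c j) ℚ.* powFam p j n))
    ≡⟨ cong₂ (λ u v → ι z₀ ℚ.* ι (+ n) ℚ.+ (u ℚ.+ v)) (ℚ.*-identityʳ (ι z₁)) (powFam-∑ p c n) ⟩
  ι z₀ ℚ.* ι (+ n) ℚ.+ (ι z₁ ℚ.+ ι (⟦ c ⟧ (F n) (F (suc n))))
    ≡⟨ cong₂ ℚ._+_ (ι-* z₀ (+ n)) (ι-+ z₁ (⟦ c ⟧ (F n) (F (suc n)))) ⟨
  ι (z₀ * + n) ℚ.+ ι (z₁ + ⟦ c ⟧ (F n) (F (suc n)))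
    ≡⟨ ι-+ (z₀ * + n) (z₁ + ⟦ c ⟧ (F n) (F (suc n))) ⟨
  ι (z₀ * + n + (z₁ + ⟦ c ⟧ (F n) (F (suc n)))) ∎
  where
  z₀ : ℤ
  z₀ = head z
  z₁ : ℤ
  z₁ = head (tail z)
  c : Form p
  c = tail (tail z)
  open ≡-Reasoning

-- Relations among the functions of the corollary

module ExtFamRelation {p} (d : Vector ℚ (3 ℕ.+ p)) (rel : IsRelation (extFam p) d) where

  open Cleared (clear-denominators d) public

  z₀ : ℤ
  z₀ = head numerator
  z₁ : ℤ
  z₁ = head (tail numerator)
  c : Form p
  c = tail (tail numerator)

  affine : AffineRelation z₀ z₁ c
  affine n = ι-injective (trans (sym (extFam-∑ p numerator n)) (Cleared-relation (extFam p) (clear-denominators d) rel n))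

  open AffineRelationProperties z₀ z₁ c affine public

powFam-linIndep : ∀ p → LinIndep (powFam p)
powFam-linIndep p d rel = numerator≡0⇒≡0 (vanishes⇒≡0 numerator (λ n → vanishes (suc n)))
  where
  open Cleared (clear-denominators d)
  vanishes : ∀ n → ⟦ numerator ⟧ (F n) (F (suc n)) ≡ 0ℤ
  vanishes n = ι-injective (trans (sym (powFam-∑ p numerator n)) (Cleared-relation (powFam p) (clear-denominators d) rel n))

extFam-linIndep : ∀ p → ¬ 4 ∣ p → LinIndep (extFam p)
extFam-linIndep p ¬4∣p d rel = numerator≡0⇒≡0 numerator≡0
  where
  open ExtFamRelation d rel
  z₁≡0 : z₁ ≡ 0ℤ
  z₁≡0 = affine-const≡0 ¬4∣p
  c-vanishes : VanishesOnF c
  c-vanishes n = trans (sym (ℤ.+-identityˡ _)) (trans (cong (_+ ⟦ c ⟧ _ _) (sym z₁≡0)) (affine-const+form≡0 (suc n)))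
  numerator≡0 : ∀ j → numerator j ≡ 0ℤ
  numerator≡0 zero          = affine-slope≡0
  numerator≡0 (suc zero)    = z₁≡0
  numerator≡0 (suc (suc j)) = vanishes⇒≡0 c c-vanishes j

unit-relation : ∀ q → Vector ℤ (3 ℕ.+ q ℕ.* 4)
unit-relation q = 0ℤ ∷ 1ℤ ∷ -1ℤ ⊙ unit-form q

unit-relation-isRelation : ∀ q → IsRelation (extFam (q ℕ.* 4)) (ι ∘ unit-relation q)
unit-relation-isRelation q n = trans (extFam-∑ (q ℕ.* 4) (unit-relation q) n) (cong ι (begin
  0ℤ * + n + (1ℤ + ⟦ -1ℤ ⊙ e ⟧ x y)   ≡⟨ cong (λ t → 0ℤ * + n + (1ℤ + t)) (⟦⊙⟧ x y -1ℤ e) ⟩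
  0ℤ * + n + (1ℤ + -1ℤ * ⟦ e ⟧ x y)   ≡⟨ cong (λ t → 0ℤ * + n + (1ℤ + -1ℤ * t)) (⟦unit-form⟧ q n) ⟩
  0ℤ                                 ∎))
  where
  e : Form (q ℕ.* 4)
  e = unit-form q
  x y : ℤ
  x = F n
  y = F (suc n)
  open ≡-Reasoning

relation⇒multiple-of-unit : ∀ q d → IsRelation (extFam (q ℕ.* 4)) d →
                            ∃ λ a → ∀ j → d j ≡ a ℚ.* ι (unit-relation q j)
relation⇒multiple-of-unit q d rel = d (suc zero) , numerator≡*⇒≡* (suc zero) (unit-relation q) numerator≡z₁*w
  where
  open ExtFamRelation d rel
  e : Form (q ℕ.* 4)
  e = unit-form q
  c⊕z₁e-vanishes : VanishesOnF (c ⊕ z₁ ⊙ e)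
  c⊕z₁e-vanishes n = begin
    ⟦ c ⊕ z₁ ⊙ e ⟧ x y               ≡⟨ ⟦⊕⟧ x y c (z₁ ⊙ e) ⟩
    ⟦ c ⟧ x y + ⟦ z₁ ⊙ e ⟧ x y        ≡⟨ cong (_+_ (⟦ c ⟧ x y)) (⟦⊙⟧ x y z₁ e) ⟩
    ⟦ c ⟧ x y + z₁ * ⟦ e ⟧ x y        ≡⟨ cong (λ t → ⟦ c ⟧ x y + z₁ * t) (⟦unit-form⟧ q (suc n)) ⟩
    ⟦ c ⟧ x y + z₁ * 1ℤ              ≡⟨ rearrange (⟦ c ⟧ x y) z₁ ⟩
    z₁ + ⟦ c ⟧ x y                   ≡⟨ affine-const+form≡0 (suc n) ⟩
    0ℤ                               ∎
    where
    x y : ℤ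
    x = F (suc n)
    y = F (suc (suc n))
    open ≡-Reasoning
    rearrange : ∀ t b → t + b * 1ℤ ≡ b + t
    rearrange = solve-∀
  numerator≡z₁*w : ∀ j → numerator j ≡ z₁ * unit-relation q j
  numerator≡z₁*w zero          = trans affine-slope≡0 (sym (ℤ.*-zeroʳ z₁))
  numerator≡z₁*w (suc zero)    = sym (ℤ.*-identityʳ z₁)
  numerator≡z₁*w (suc (suc j)) = begin
    c j                                   ≡⟨ rearrange (c j) z₁ (e j) ⟩
    (c j + z₁ * e j) + z₁ * (-1ℤ * e j)
      ≡⟨ cong (_+ z₁ * (-1ℤ * e j)) (vanishes⇒≡0 (c ⊕ z₁ ⊙ e) c⊕z₁e-vanishes j) ⟩
    0ℤ + z₁ * (-1ℤ * e j)                 ≡⟨ ℤ.+-identityˡ _ ⟩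
    z₁ * (-1ℤ * e j)                      ∎
    where
    open ≡-Reasoning
    rearrange : ∀ a b e → a ≡ (a + b * e) + b * (-1ℤ * e)
    rearrange = solve-∀

extFam-relSpaceDim1 : ∀ q → RelSpaceDim1 (extFam (q ℕ.* 4))
extFam-relSpaceDim1 q =
  ι ∘ unit-relation q , unit-relation-isRelation q , (λ w≡0 → ℚ.1≢0 (w≡0 (suc zero))) , relation⇒multiple-of-unit q

corollary6 : (p : ℕ) → 1 ≤ p →
    LinIndep (powFam p)
    × (¬ (4 ∣ p) → LinIndep (extFam p))
    × (4 ∣ p → RelSpaceDim1 (extFam p))
corollary6 p _ = powFam-linIndep p , extFam-linIndep p , relSpaceDim1
  where
  relSpaceDim1 : 4 ∣ p → RelSpaceDim1 (extFam p)
  relSpaceDim1 (divides q refl) = extFam-relSpaceDim1 q
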